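{- Let $\lambda$ be a partition with $\lambda_i\ge i$ for all $i$ and GJW sequence $(g_1,\dots,g_n)$. For each row $i$, the number of maximal rook placements obtainable from $\hat{1}$ by a single switch move on rook $i$ or push move on rook $i$ is exactly $1$ if $g_i\neq 0$ and $0$ if $g_i=0$. Consequently, sending $i$ to the placement so obtained gives a bijection between $\{i: g_i\ne 0\}$ and the set of coatoms of $P_\lambda$.
   Context: Partition $\lambda=(\lambda_1\le\cdots\le\lambda_n)$, Ferrers board cells $(i,j)$ (row $i$ from the bottom, column $j$), $1\le j\le\lambda_i$; GJW sequence $g_i=\lambda_i-i$. A maximal rook placement is a sequence $x=(x_1,\dots,x_n)$ of distinct integers with $1\le x_i\le\lambda_i$ (rook in cell $(i,x_i)$). Rook poset $P_\lambda$: $x\le y$ iff for all $j$ the sorted list of $\{x_1,\dots,x_j\}$ is entrywise $\le$ that of $\{y_1,\dots,y_j\}$. Its maximum $\hat{1}$ is given by $\hat{1}_i=\max(\{1,\dots,\lambda_i\}\setminus\{\hat{1}_1,\dots,\hat{1}_{i-1}\})$. A coatom is an element covered by $\hat{1}$. The covering relations of $P_\lambda$ are exactly given by the following moves (the lower element is obtained from the upper one). Switch move on rook $i$: if rooks occupy $(i,j)$ and $(k,l)$ with $i<k$, $j>l$, and the rectangle with these corners contains no other rooks, replace them by rooks at $(i,l)$ and $(k,j)$. Push move on rook $i$: if a rook occupies $(i,j)$, column $k<j$ contains no rook, and for every $k<r<j$ column $r$ contains a rook in a row below $i$, replace the rook at $(i,j)$ by one at $(i,k)$. -}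

module Defs where

open import Data.Nat using (ℕ; zero; suc; _≤_; _<_)
open import Data.Nat.Properties using (≤-decTotalOrder; _≟_)
open import Data.Integer using (ℤ; +_; _-_)
open import Data.Fin as Fin using (Fin; toℕ)
open import Data.Vec using (Vec; []; _∷_; lookup; toList; _[_]≔_)
open import Data.List using (List; take)
import Data.List as List
open import Data.List.Membership.DecPropositional _≟_ using (_∈?_)
open import Data.List.Relation.Binary.Pointwise using (Pointwise)
open import Data.List.Sort ≤-decTotalOrder using (sort)
open import Data.Product using (Σ; ∃; _×_; _,_)
open import Relation.Nullary using (¬_; yes; no)
open import Relation.Binary.PropositionalEquality using (_≡_; _≢_)

-- Conventions: rows are indexed 0-based by Fin n, i.e. Fin index i is
-- row (toℕ i + 1) of the paper.  Columns are the actual positive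
-- integers 1,2,...

IsPartition : ∀ {n} → Vec ℕ n → Set
IsPartition {n} λ' = ∀ (i j : Fin n) → i Fin.≤ j → lookup λ' i ≤ lookup λ' j

gjw : ∀ {n} → Vec ℕ n → Fin n → ℤ
gjw λ' i = + lookup λ' i - + suc (toℕ i)

IsPlacement : ∀ {n} → Vec ℕ n → Vec ℕ n → Set
IsPlacement {n} λ' x =
  (∀ (i : Fin n) → 1 ≤ lookup x i × lookup x i ≤ lookup λ' i) ×
  (∀ (i j : Fin n) → lookup x i ≡ lookup x j → i ≡ j)

-- largest element of {1,...,m} not in `used` (0 if none)
maxAvail : ℕ → List ℕ → ℕ
maxAvail zero used = zero
maxAvail (suc m) used with suc m ∈? used
... | yes _ = maxAvail m used
... | no  _ = suc m

hat1-aux : ∀ {n} → List ℕ → Vec ℕ n → Vec ℕ n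
hat1-aux used [] = []
hat1-aux used (l ∷ ls) = maxAvail l used ∷ hat1-aux (maxAvail l used List.∷ used) ls

-- the maximum 1̂ of P_λ: 1̂_i = max({1..λ_i} \ {1̂_1,...,1̂_{i-1}})
hat1 : ∀ {n} → Vec ℕ n → Vec ℕ n
hat1 λ' = hat1-aux List.[] λ'

_≤P_ : ∀ {n} → Vec ℕ n → Vec ℕ n → Set
_≤P_ {n} x y = ∀ (j : ℕ) → j ≤ n →
  Pointwise _≤_ (sort (take j (toList x))) (sort (take j (toList y)))

Covers : ∀ {n} → Vec ℕ n → Vec ℕ n → Vec ℕ n → Set
Covers {n} λ' x y =
  x ≤P y × x ≢ y ×
  (∀ (z : Vec ℕ n) → IsPlacement λ' z → x ≤P z → z ≤P y → z ≡ x Data.Sum.⊎ z ≡ y)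
  where import Data.Sum

IsCoatom : ∀ {n} → Vec ℕ n → Vec ℕ n → Set
IsCoatom λ' x = IsPlacement λ' x × Covers λ' x (hat1 λ')

SwitchMove : ∀ {n} → Fin n → Vec ℕ n → Vec ℕ n → Set
SwitchMove {n} i y x = Σ (Fin n) λ k →
  i Fin.< k × lookup y k < lookup y i ×
  (∀ (m : Fin n) → m ≢ i → m ≢ k →
     ¬ (i Fin.≤ m × m Fin.≤ k × lookup y k ≤ lookup y m × lookup y m ≤ lookup y i)) ×
  x ≡ ((y [ i ]≔ lookup y k) [ k ]≔ lookup y i)

PushMove : ∀ {n} → Fin n → Vec ℕ n → Vec ℕ n → Set
PushMove {n} i y x = Σ ℕ λ c →
  1 ≤ c × c < lookup y i ×
  (∀ (m : Fin n) → lookup y m ≢ c) ×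
  (∀ (r : ℕ) → c < r → r < lookup y i → Σ (Fin n) λ m → m Fin.< i × lookup y m ≡ r) ×
  x ≡ (y [ i ]≔ c)

ObtainableOn : ∀ {n} → Vec ℕ n → Fin n → Vec ℕ n → Set
ObtainableOn λ' i x =
  IsPlacement λ' x × (SwitchMove i (hat1 λ') x Data.Sum.⊎ PushMove i (hat1 λ') x)
  where import Data.Sum

-- The rook order compares sorted prefixes entrywise, which for sorted lists amounts to
-- comparing, for every threshold t and length j, how many of x₁ … x_j are at least t.
-- Through these counts, the greedy placement 1̂ dominates every placement (exchange
-- argument), and a placement x ≠ 1̂ first differing from 1̂ in row i has x_i < 1̂_i in a
-- column of row i that 1̂ leaves free in rows ≤ i. By pigeonhole row i has such a free
-- column iff λ_i ≥ i + 2, i.e. g_i ≠ 0. A switch or push on rook i of 1̂ must move it to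
-- the largest free column c of row i (switching with the row holding c, or pushing when
-- no row does), so there is at most one such move, and one exists when g_i ≠ 0. Its
-- result y lies above every placement first differing from 1̂ in row i, and only 1̂ lies
-- strictly above y; so y is a coatom, and each coatom is the y of its first row of difference.

module Submission where

open import Data.Nat using (ℕ; zero; suc; pred; _⊓_; >-nonZero; _+_; _≤_; _<_; z≤n; s≤s; z<s; _≤?_; _<?_)
open import Data.Nat.ListAction using (sum)
open import Data.Nat.ListAction.Properties using (sum-↭)
open import Data.Nat.Properties
open import Algebra.Properties.CommutativeSemigroup using (xy∙z≈zy∙x)
open import Data.Empty using (⊥-elim)
open import Data.Fin as Fin using (Fin; toℕ; fromℕ<)
import Data.Fin.Properties as Fin
open import Data.Fin.Properties
  using (toℕ-fromℕ<; toℕ-injective; toℕ<n; injective⇒≤; toℕ-inject≤; inject≤-injective; any?)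
open import Data.Integer using (+_)
import Data.Integer.Properties as ℤ
open import Data.List using (List; []; _∷_; length; map; take)
open import Data.List.Properties using (length-take)
open import Data.List.Membership.DecPropositional _≟_ using (_∈_; _∈?_)
open import Data.List.Relation.Binary.Permutation.Propositional using (_↭_)
open import Data.List.Relation.Binary.Permutation.Propositional.Properties using (map⁺; ↭-length)
open import Data.List.Relation.Binary.Pointwise using (Pointwise; []; _∷_)
open import Data.List.Relation.Unary.All using (All; []; _∷_)
open import Data.List.Relation.Unary.Any using (here; there)
open import Data.List.Relation.Unary.Linked as Linked using (Linked)
open import Data.List.Relation.Unary.Linked.Properties using (Linked⇒All)
open import Data.List.Sort ≤-decTotalOrder using (sort; sort-↭; sort-↗)
open import Data.Product using (Σ; _×_; _,_; proj₁; proj₂)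
open import Data.Sum using (_⊎_; inj₁; inj₂)
open import Data.Vec using (Vec; []; _∷_; lookup; toList; _[_]≔_)
open import Data.Vec.Properties using (length-toList; lookup∘update; lookup∘update′; ≡-dec)
open import Data.Vec.Relation.Binary.Pointwise.Extensional using (ext; Pointwise-≡⇒≡)
open import Function using (_∘_)
open import Relation.Binary.Definitions using (tri<; tri≈; tri>)
open import Relation.Binary.PropositionalEquality
open import Relation.Nullary using (¬_; Dec; yes; no; _×-dec_)
open import Relation.Unary using (Pred; Decidable)

open import Defs

-- Counting entries above a threshold

𝟙[_≤_] : ℕ → ℕ → ℕ
𝟙[ t ≤ a ] with t ≤? a
... | yes _ = 1
... | no  _ = 0

𝟙-yes : ∀ {t a} → t ≤ a → 𝟙[ t ≤ a ] ≡ 1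
𝟙-yes {t} {a} t≤a with t ≤? a
... | yes _   = refl
... | no  t≰a = ⊥-elim (t≰a t≤a)

𝟙-no : ∀ {t a} → a < t → 𝟙[ t ≤ a ] ≡ 0
𝟙-no {t} {a} a<t with t ≤? a
... | yes t≤a = ⊥-elim (<⇒≱ a<t t≤a)
... | no  _   = refl

𝟙≡1⇒≤ : ∀ {t a} → 𝟙[ t ≤ a ] ≡ 1 → t ≤ a
𝟙≡1⇒≤ {t} {a} eq with t ≤? a
𝟙≡1⇒≤ {t} {a} ()   | no _
... | yes t≤a = t≤a

𝟙≤1 : ∀ t a → 𝟙[ t ≤ a ] ≤ 1
𝟙≤1 t a with t ≤? a
... | yes _ = ≤-refl
... | no  _ = z≤n

𝟙-mono : ∀ t {a b} → a ≤ b → 𝟙[ t ≤ a ] ≤ 𝟙[ t ≤ b ]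
𝟙-mono t {a} {b} a≤b with t ≤? a | t ≤? b
... | yes _   | yes _   = ≤-refl
... | yes t≤a | no  t≰b = ⊥-elim (t≰b (≤-trans t≤a a≤b))
... | no  _   | _       = z≤n

𝟙-exchange : ∀ {p q t a b} → p + 𝟙[ t ≤ a ] ≡ q + 𝟙[ t ≤ b ] → b ≤ a →
  p ≡ q ⊎ (b < t × t ≤ a × suc p ≡ q)
𝟙-exchange {p} {q} {t} {a} {b} eq b≤a = cases (≤-<-connex t b) (≤-<-connex t a)
  where
  evaluate : ∀ {u v} → 𝟙[ t ≤ a ] ≡ u → 𝟙[ t ≤ b ] ≡ v → p + u ≡ q + v
  evaluate refl refl = eq
  cases : t ≤ b ⊎ b < t → t ≤ a ⊎ a < t → p ≡ q ⊎ (b < t × t ≤ a × suc p ≡ q)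
  cases (inj₁ t≤b) _          = inj₁ (+-cancelʳ-≡ 1 p q (evaluate (𝟙-yes (≤-trans t≤b b≤a)) (𝟙-yes t≤b)))
  cases (inj₂ b<t) (inj₂ a<t) = inj₁ (+-cancelʳ-≡ 0 p q (evaluate (𝟙-no a<t) (𝟙-no b<t)))
  cases (inj₂ b<t) (inj₁ t≤a) =
    inj₂ (b<t , t≤a , trans (+-comm 1 p) (trans (evaluate (𝟙-yes t≤a) (𝟙-no b<t)) (+-identityʳ q)))

𝟙-exchange-≤ : ∀ {p q t a b} → p + 𝟙[ t ≤ b ] ≡ q + 𝟙[ t ≤ a ] → b ≤ a → q ≤ p
𝟙-exchange-≤ {p} {q} {t} {a} {b} eq b≤a =
  +-cancelʳ-≤ 𝟙[ t ≤ b ] q p (≤-trans (+-monoʳ-≤ q (𝟙-mono t b≤a)) (≤-reflexive (sym eq)))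

count≥ : ℕ → List ℕ → ℕ
count≥ t l = sum (map (λ a → 𝟙[ t ≤ a ]) l)

count≥-↭ : ∀ t {l l′} → l ↭ l′ → count≥ t l ≡ count≥ t l′
count≥-↭ t l↭l′ = sum-↭ (map⁺ _ l↭l′)

count≥-mono : ∀ t {l l′} → Pointwise _≤_ l l′ → count≥ t l ≤ count≥ t l′
count≥-mono t []             = z≤n
count≥-mono t (a≤b ∷ l≤l′) = +-mono-≤ (𝟙-mono t a≤b) (count≥-mono t l≤l′)

count≥≤length : ∀ t l → count≥ t l ≤ length l
count≥≤length t []      = z≤n
count≥≤length t (a ∷ l) = +-mono-≤ (𝟙≤1 t a) (count≥≤length t l)

count≥-all : ∀ {t l} → All (t ≤_) l → count≥ t l ≡ length l
count≥-all []           = refl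
count≥-all (t≤a ∷ t≤l) = cong₂ _+_ (𝟙-yes t≤a) (count≥-all t≤l)

count≥-sorted : ∀ {t a l} → Linked _≤_ (a ∷ l) → t ≤ a → count≥ t (a ∷ l) ≡ length (a ∷ l)
count≥-sorted sorted t≤a = count≥-all (Linked⇒All ≤-trans t≤a sorted)

count≥-sorted-tail : ∀ {t a l} → Linked _≤_ (a ∷ l) → t ≤ a → count≥ t l ≡ length l
count≥-sorted-tail sorted t≤a with Linked⇒All ≤-trans t≤a sorted
... | _ ∷ t≤l = count≥-all t≤l

count≥⇒pointwise : ∀ {l l′} → Linked _≤_ l → Linked _≤_ l′ → length l ≡ length l′ →
  (∀ t → count≥ t l ≤ count≥ t l′) → Pointwise _≤_ l l′
count≥⇒pointwise {[]}    {[]}     _ _ _ _ = []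
count≥⇒pointwise {a ∷ l} {b ∷ l′} sorted sorted′ len counts =
  a≤b ∷ count≥⇒pointwise (Linked.tail sorted) (Linked.tail sorted′) len′ tail-counts
  where
  len′ : length l ≡ length l′
  len′ = suc-injective len
  a≤b : a ≤ b
  a≤b with ≤-<-connex a b
  ... | inj₁ a≤b = a≤b
  ... | inj₂ b<a = ⊥-elim (<-irrefl refl (begin-strict
    length l′                 ≡⟨ len′ ⟨
    length l                  <⟨ ≤-reflexive (sym (count≥-sorted sorted ≤-refl)) ⟩
    count≥ a (a ∷ l)          ≤⟨ counts a ⟩
    𝟙[ a ≤ b ] + count≥ a l′  ≡⟨ cong (_+ count≥ a l′) (𝟙-no b<a) ⟩
    count≥ a l′               ≤⟨ count≥≤length a l′ ⟩
    length l′                 ∎))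
    where open ≤-Reasoning
  tail-counts : ∀ t → count≥ t l ≤ count≥ t l′
  tail-counts t with ≤-<-connex t b
  ... | inj₁ t≤b = begin
    count≥ t l   ≤⟨ count≥≤length t l ⟩
    length l     ≡⟨ len′ ⟩
    length l′    ≡⟨ count≥-sorted-tail sorted′ t≤b ⟨
    count≥ t l′  ∎
    where open ≤-Reasoning
  ... | inj₂ b<t = begin
    count≥ t l                ≡⟨ cong (_+ count≥ t l) (𝟙-no (≤-<-trans a≤b b<t)) ⟨
    𝟙[ t ≤ a ] + count≥ t l   ≤⟨ counts t ⟩
    𝟙[ t ≤ b ] + count≥ t l′  ≡⟨ cong (_+ count≥ t l′) (𝟙-no b<t) ⟩
    count≥ t l′               ∎
    where open ≤-Reasoning

prefix≥ : ∀ {n} → ℕ → ℕ → Vec ℕ n → ℕ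
prefix≥ t j x = count≥ t (take j (toList x))

_≼_ : ∀ {n} → Vec ℕ n → Vec ℕ n → Set
_≼_ {n} x y = ∀ t j → j ≤ n → prefix≥ t j x ≤ prefix≥ t j y

≼-trans : ∀ {n} {x y z : Vec ℕ n} → x ≼ y → y ≼ z → x ≼ z
≼-trans x≼y y≼z t j j≤n = ≤-trans (x≼y t j j≤n) (y≼z t j j≤n)

count≥-sort : ∀ t l → count≥ t (sort l) ≡ count≥ t l
count≥-sort t l = count≥-↭ t (sort-↭ l)

≤P⇒≼ : ∀ {n} {x y : Vec ℕ n} → x ≤P y → x ≼ y
≤P⇒≼ {x = x} {y} x≤y t j j≤n = begin
  prefix≥ t j x                        ≡⟨ count≥-sort t _ ⟨
  count≥ t (sort (take j (toList x)))  ≤⟨ count≥-mono t (x≤y j j≤n) ⟩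
  count≥ t (sort (take j (toList y)))  ≡⟨ count≥-sort t _ ⟩
  prefix≥ t j y                        ∎
  where open ≤-Reasoning

length-sort-take : ∀ {n} (x : Vec ℕ n) j → j ≤ n → length (sort (take j (toList x))) ≡ j
length-sort-take {n} x j j≤n = begin
  length (sort (take j (toList x)))  ≡⟨ ↭-length (sort-↭ _) ⟩
  length (take j (toList x))         ≡⟨ length-take j (toList x) ⟩
  j ⊓ length (toList x)              ≡⟨ cong (j ⊓_) (length-toList x) ⟩
  j ⊓ n                              ≡⟨ m≤n⇒m⊓n≡m j≤n ⟩
  j                                  ∎
  where open ≡-Reasoning

≼⇒≤P : ∀ {n} {x y : Vec ℕ n} → x ≼ y → x ≤P y
≼⇒≤P {x = x} {y} x≼y j j≤n = count≥⇒pointwise (sort-↗ _) (sort-↗ _) same-length counts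
  where
  same-length : length (sort (take j (toList x))) ≡ length (sort (take j (toList y)))
  same-length = trans (length-sort-take x j j≤n) (sym (length-sort-take y j j≤n))
  counts : ∀ t → count≥ t (sort (take j (toList x))) ≤ count≥ t (sort (take j (toList y)))
  counts t = subst₂ _≤_ (sym (count≥-sort t _)) (sym (count≥-sort t _)) (x≼y t j j≤n)

AgreeBelow : ∀ {n} → ℕ → Vec ℕ n → Vec ℕ n → Set
AgreeBelow p x y = ∀ m → toℕ m < p → lookup x m ≡ lookup y m

AgreeBelow-suc : ∀ {n} {x y : Vec ℕ n} {r} → AgreeBelow (toℕ r) x y → lookup x r ≡ lookup y r →
  AgreeBelow (suc (toℕ r)) x y
AgreeBelow-suc {x = x} {y} {r} agree same m m<1+r with m<1+n⇒m<n∨m≡n m<1+r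
... | inj₁ m<r = agree m m<r
... | inj₂ m≡r = subst (λ q → lookup x q ≡ lookup y q) (sym (toℕ-injective m≡r)) same

firstDiff : ∀ {n} (x y : Vec ℕ n) → x ≢ y → Σ (Fin n) λ i → AgreeBelow (toℕ i) x y × lookup x i ≢ lookup y i
firstDiff []      []      x≢y = ⊥-elim (x≢y refl)
firstDiff (a ∷ x) (b ∷ y) x≢y with a ≟ b
... | no  a≢b  = Fin.zero , (λ _ ()) , a≢b
... | yes refl with firstDiff x y (x≢y ∘ cong (a ∷_))
...   | i , agree , differ = Fin.suc i , agree′ , differ
  where
  agree′ : AgreeBelow (suc (toℕ i)) (a ∷ x) (b ∷ y)
  agree′ Fin.zero    _          = refl
  agree′ (Fin.suc m) (s≤s m<i) = agree m m<i

firstDiff-unique : ∀ {n} (x y : Vec ℕ n) {i j} → AgreeBelow (toℕ i) x y → lookup x i ≢ lookup y i →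
  AgreeBelow (toℕ j) x y → lookup x j ≢ lookup y j → i ≡ j
firstDiff-unique x y {i} {j} agreeᵢ differᵢ agreeⱼ differⱼ with <-cmp (toℕ i) (toℕ j)
... | tri< i<j _ _ = ⊥-elim (differᵢ (agreeⱼ i i<j))
... | tri≈ _ i≡j _ = toℕ-injective i≡j
... | tri> _ _ j<i = ⊥-elim (differⱼ (agreeᵢ j j<i))

prefix≥-suc : ∀ {n} t (x : Vec ℕ n) (m : Fin n) →
  prefix≥ t (suc (toℕ m)) x ≡ prefix≥ t (toℕ m) x + 𝟙[ t ≤ lookup x m ]
prefix≥-suc t (a ∷ x) Fin.zero    = +-identityʳ _
prefix≥-suc t (a ∷ x) (Fin.suc m) =
  trans (cong (_+_ 𝟙[ t ≤ a ]) (prefix≥-suc t x m)) (sym (+-assoc 𝟙[ t ≤ a ] _ _))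

prefix≥-sucℕ : ∀ {n} t (x : Vec ℕ n) {j} (j<n : j < n) →
  prefix≥ t (suc j) x ≡ prefix≥ t j x + 𝟙[ t ≤ lookup x (fromℕ< j<n) ]
prefix≥-sucℕ t x j<n =
  subst (λ k → prefix≥ t (suc k) x ≡ prefix≥ t k x + 𝟙[ t ≤ lookup x m ]) (toℕ-fromℕ< j<n) (prefix≥-suc t x m)
  where
  m : Fin _
  m = fromℕ< j<n

prefix≥-suc≤ : ∀ {n} t j (x : Vec ℕ n) → prefix≥ t (suc j) x ≤ suc (prefix≥ t j x)
prefix≥-suc≤ t j       []      = z≤n
prefix≥-suc≤ t zero    (a ∷ x) = +-monoˡ-≤ 0 (𝟙≤1 t a)
prefix≥-suc≤ t (suc j) (a ∷ x) =
  ≤-trans (+-monoʳ-≤ 𝟙[ t ≤ a ] (prefix≥-suc≤ t j x)) (≤-reflexive (+-suc 𝟙[ t ≤ a ] _))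

prefix≥-cong : ∀ {n} t j {x y : Vec ℕ n} → AgreeBelow j x y → prefix≥ t j x ≡ prefix≥ t j y
prefix≥-cong t zero    _ = refl
prefix≥-cong t (suc j) {[]}    {[]}    _     = refl
prefix≥-cong t (suc j) {a ∷ x} {b ∷ y} agree =
  cong₂ _+_ (cong 𝟙[ t ≤_] (agree Fin.zero (s≤s z≤n)))
            (prefix≥-cong t j (λ m m<j → agree (Fin.suc m) (s≤s m<j)))

prefix≥-update-before : ∀ {n} t j (x : Vec ℕ n) (k : Fin n) a → j ≤ toℕ k →
  prefix≥ t j (x [ k ]≔ a) ≡ prefix≥ t j x
prefix≥-update-before t zero    x       k           a _         = refl
prefix≥-update-before t (suc j) (b ∷ x) (Fin.suc k) a (s≤s j≤k) =
  cong (_+_ 𝟙[ t ≤ b ]) (prefix≥-update-before t j x k a j≤k)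

prefix≥-update : ∀ {n} t j (x : Vec ℕ n) (k : Fin n) a → toℕ k < j →
  prefix≥ t j (x [ k ]≔ a) + 𝟙[ t ≤ lookup x k ] ≡ prefix≥ t j x + 𝟙[ t ≤ a ]
prefix≥-update t (suc j) (b ∷ x) Fin.zero    a _         = xy∙z≈zy∙x +-commutativeSemigroup 𝟙[ t ≤ a ] _ 𝟙[ t ≤ b ]
prefix≥-update t (suc j) (b ∷ x) (Fin.suc k) a (s≤s k<j) = begin
  𝟙[ t ≤ b ] + prefix≥ t j (x [ k ]≔ a) + 𝟙[ t ≤ lookup x k ]
    ≡⟨ +-assoc 𝟙[ t ≤ b ] _ _ ⟩
  𝟙[ t ≤ b ] + (prefix≥ t j (x [ k ]≔ a) + 𝟙[ t ≤ lookup x k ])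
    ≡⟨ cong (_+_ 𝟙[ t ≤ b ]) (prefix≥-update t j x k a k<j) ⟩
  𝟙[ t ≤ b ] + (prefix≥ t j x + 𝟙[ t ≤ a ])
    ≡⟨ +-assoc 𝟙[ t ≤ b ] _ _ ⟨
  𝟙[ t ≤ b ] + prefix≥ t j x + 𝟙[ t ≤ a ]
    ∎
  where open ≡-Reasoning

prefix≥-injective : ∀ {n} {x y : Vec ℕ n} → (∀ t j → j ≤ n → prefix≥ t j x ≡ prefix≥ t j y) → x ≡ y
prefix≥-injective {x = []}    {[]}    same = refl
prefix≥-injective {x = a ∷ x} {b ∷ y} same = cong₂ _∷_ a≡b (prefix≥-injective same-tail)
  where
  same-head : ∀ t → 𝟙[ t ≤ a ] ≡ 𝟙[ t ≤ b ]
  same-head t = +-cancelʳ-≡ 0 _ _ (same t 1 (s≤s z≤n))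
  a≡b : a ≡ b
  a≡b = ≤-antisym (𝟙≡1⇒≤ (trans (sym (same-head a)) (𝟙-yes ≤-refl)))
                  (𝟙≡1⇒≤ (trans (same-head b) (𝟙-yes ≤-refl)))
  same-tail : ∀ t j → j ≤ _ → prefix≥ t j x ≡ prefix≥ t j y
  same-tail t j j≤n =
    +-cancelˡ-≡ 𝟙[ t ≤ a ] _ _
      (trans (same t (suc j) (s≤s j≤n)) (cong (λ c → 𝟙[ t ≤ c ] + prefix≥ t j y) (sym a≡b)))

prefix≥-gap : ∀ {n} t (x z : Vec ℕ n) (i : Fin n) → AgreeBelow (toℕ i) x z → lookup x i < t → t ≤ lookup z i →
  ∀ j → toℕ i < j → j ≤ n → (∀ m → toℕ i < toℕ m → toℕ m < j → t ≤ lookup z m) →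
  prefix≥ t j x < prefix≥ t j z
prefix≥-gap t x z i agree xᵢ<t t≤zᵢ (suc j) i<1+j 1+j≤n above with m<1+n⇒m<n∨m≡n i<1+j
... | inj₂ refl = begin-strict
  prefix≥ t (suc (toℕ i)) x                  ≡⟨ prefix≥-suc t x i ⟩
  prefix≥ t (toℕ i) x + 𝟙[ t ≤ lookup x i ]  ≡⟨ cong₂ _+_ (prefix≥-cong t (toℕ i) agree) (𝟙-no xᵢ<t) ⟩
  prefix≥ t (toℕ i) z + 0                    <⟨ +-monoʳ-< (prefix≥ t (toℕ i) z) (≤-reflexive (sym (𝟙-yes t≤zᵢ))) ⟩
  prefix≥ t (toℕ i) z + 𝟙[ t ≤ lookup z i ]  ≡⟨ prefix≥-suc t z i ⟨
  prefix≥ t (suc (toℕ i)) z                  ∎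
  where open ≤-Reasoning
... | inj₁ i<j = begin-strict
  prefix≥ t (suc j) x                             ≤⟨ prefix≥-suc≤ t j x ⟩
  suc (prefix≥ t j x)                             ≤⟨ prefix≥-gap t x z i agree xᵢ<t t≤zᵢ j i<j (<⇒≤ 1+j≤n) above′ ⟩
  prefix≥ t j z                                   <⟨ m<m+n _ (≤-reflexive (sym (𝟙-yes t≤zⱼ))) ⟩
  prefix≥ t j z + 𝟙[ t ≤ lookup z (fromℕ< 1+j≤n) ] ≡⟨ prefix≥-sucℕ t z 1+j≤n ⟨
  prefix≥ t (suc j) z                             ∎
  where
  open ≤-Reasoning
  above′ : ∀ m → toℕ i < toℕ m → toℕ m < j → t ≤ lookup z m
  above′ m i<m m<j = above m i<m (m<n⇒m<1+n m<j)
  t≤zⱼ : t ≤ lookup z (fromℕ< 1+j≤n)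
  t≤zⱼ = above (fromℕ< 1+j≤n) (subst (toℕ i <_) (sym (toℕ-fromℕ< 1+j≤n)) i<j)
               (s≤s (≤-reflexive (toℕ-fromℕ< 1+j≤n)))

-- Changing one or two rows

swapRows : ∀ {n} → Vec ℕ n → Fin n → Fin n → Vec ℕ n
swapRows x i k = (x [ i ]≔ lookup x k) [ k ]≔ lookup x i

data Updated {n} (x : Vec ℕ n) (k : Fin n) (a : ℕ) : Fin n → ℕ → Set where
  at-k  : Updated x k a k a
  other : ∀ {m} → m ≢ k → Updated x k a m (lookup x m)

updated : ∀ {n} (x : Vec ℕ n) k a m → Updated x k a m (lookup (x [ k ]≔ a) m)
updated x k a m with m Fin.≟ k
... | yes refl = subst (Updated x k a m) (sym (lookup∘update m x a)) at-k
... | no  m≢k  = subst (Updated x k a m) (sym (lookup∘update′ m≢k x a)) (other m≢k)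

module _ {n} (x : Vec ℕ n) {i k : Fin n} where

  swapRows-at-k : lookup (swapRows x i k) k ≡ lookup x i
  swapRows-at-k = lookup∘update k (x [ i ]≔ lookup x k) (lookup x i)

  swapRows-at-i : i ≢ k → lookup (swapRows x i k) i ≡ lookup x k
  swapRows-at-i i≢k =
    trans (lookup∘update′ i≢k (x [ i ]≔ lookup x k) (lookup x i)) (lookup∘update i x (lookup x k))

  swapRows-other : ∀ {m} → m ≢ i → m ≢ k → lookup (swapRows x i k) m ≡ lookup x m
  swapRows-other m≢i m≢k =
    trans (lookup∘update′ m≢k (x [ i ]≔ lookup x k) (lookup x i)) (lookup∘update′ m≢i x (lookup x k))

update-agreeBelow : ∀ {n} (x : Vec ℕ n) k a → AgreeBelow (toℕ k) (x [ k ]≔ a) x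
update-agreeBelow x k a m m<k = lookup∘update′ (Fin.<⇒≢ m<k) x a

swapRows-agreeBelow : ∀ {n} (x : Vec ℕ n) {i k} → toℕ i < toℕ k → AgreeBelow (toℕ i) (swapRows x i k) x
swapRows-agreeBelow x i<k m m<i = swapRows-other x (Fin.<⇒≢ m<i) (Fin.<⇒≢ (<-trans m<i i<k))

data Swapped {n} (x : Vec ℕ n) (i k : Fin n) : Fin n → ℕ → Set where
  at-i  : Swapped x i k i (lookup x k)
  at-k  : Swapped x i k k (lookup x i)
  other : ∀ {m} → m ≢ i → m ≢ k → Swapped x i k m (lookup x m)

swapped : ∀ {n} (x : Vec ℕ n) {i k} → i ≢ k → ∀ m → Swapped x i k m (lookup (swapRows x i k) m)
swapped x {i} {k} i≢k m with m Fin.≟ i | m Fin.≟ k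
... | yes refl | _        = subst (Swapped x i k m) (sym (swapRows-at-i x i≢k)) at-i
... | no  _    | yes refl = subst (Swapped x i k m) (sym (swapRows-at-k x)) at-k
... | no  m≢i  | no  m≢k  = subst (Swapped x i k m) (sym (swapRows-other x m≢i m≢k)) (other m≢i m≢k)

update-placement : ∀ {n} (λ' x : Vec ℕ n) {k a} → IsPlacement λ' x → 1 ≤ a → a ≤ lookup λ' k →
  (∀ m → m ≢ k → lookup x m ≢ a) → IsPlacement λ' (x [ k ]≔ a)
update-placement λ' x {k} {a} (bounds , distinct) 1≤a a≤λₖ fresh = bounds′ , distinct′
  where
  bounds′ : ∀ m → 1 ≤ lookup (x [ k ]≔ a) m × lookup (x [ k ]≔ a) m ≤ lookup λ' m
  bounds′ m with lookup (x [ k ]≔ a) m | updated x k a m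
  ... | _ | at-k    = 1≤a , a≤λₖ
  ... | _ | other _ = bounds m
  distinct′ : ∀ p q → lookup (x [ k ]≔ a) p ≡ lookup (x [ k ]≔ a) q → p ≡ q
  distinct′ p q with lookup (x [ k ]≔ a) p | updated x k a p | lookup (x [ k ]≔ a) q | updated x k a q
  ... | _ | at-k      | _ | at-k      = λ _ → refl
  ... | _ | at-k      | _ | other q≢k = λ e → ⊥-elim (fresh q q≢k (sym e))
  ... | _ | other p≢k | _ | at-k      = λ e → ⊥-elim (fresh p p≢k e)
  ... | _ | other _   | _ | other _   = distinct p q

swapRows-placement : ∀ {n} (λ' x : Vec ℕ n) {i k} → IsPlacement λ' x → i ≢ k →
  lookup x k ≤ lookup λ' i → lookup x i ≤ lookup λ' k → IsPlacement λ' (swapRows x i k)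
swapRows-placement λ' x {i} {k} (bounds , distinct) i≢k xₖ≤λᵢ xᵢ≤λₖ = bounds′ , distinct′
  where
  s : Vec ℕ _
  s = swapRows x i k
  bounds′ : ∀ m → 1 ≤ lookup s m × lookup s m ≤ lookup λ' m
  bounds′ m with lookup s m | swapped x i≢k m
  ... | _ | at-i      = proj₁ (bounds k) , xₖ≤λᵢ
  ... | _ | at-k      = proj₁ (bounds i) , xᵢ≤λₖ
  ... | _ | other _ _ = bounds m
  distinct′ : ∀ p q → lookup s p ≡ lookup s q → p ≡ q
  distinct′ p q with lookup s p | swapped x i≢k p | lookup s q | swapped x i≢k q
  ... | _ | at-i          | _ | at-i          = λ _ → refl
  ... | _ | at-i          | _ | at-k          = λ e → ⊥-elim (i≢k (sym (distinct k i e)))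
  ... | _ | at-i          | _ | other _ q≢k   = λ e → ⊥-elim (q≢k (sym (distinct k q e)))
  ... | _ | at-k          | _ | at-i          = λ e → ⊥-elim (i≢k (distinct i k e))
  ... | _ | at-k          | _ | at-k          = λ _ → refl
  ... | _ | at-k          | _ | other q≢i _   = λ e → ⊥-elim (q≢i (sym (distinct i q e)))
  ... | _ | other _ p≢k   | _ | at-i          = λ e → ⊥-elim (p≢k (distinct p k e))
  ... | _ | other p≢i _   | _ | at-k          = λ e → ⊥-elim (p≢i (distinct p i e))
  ... | _ | other _ _     | _ | other _ _     = distinct p q

update-≼ : ∀ {n} (x : Vec ℕ n) k {a} → lookup x k ≤ a → x ≼ (x [ k ]≔ a)
update-≼ x k {a} xₖ≤a t j _ with toℕ k <? j
... | yes k<j = 𝟙-exchange-≤ (prefix≥-update t j x k a k<j) xₖ≤a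
... | no  k≮j = ≤-reflexive (sym (prefix≥-update-before t j x k a (≮⇒≥ k≮j)))

module _ {n} (x : Vec ℕ n) {i k : Fin n} (i<k : toℕ i < toℕ k) where

  private
    y : Vec ℕ n
    y = x [ i ]≔ lookup x k
    yₖ≡xₖ : lookup y k ≡ lookup x k
    yₖ≡xₖ = lookup∘update′ (Fin.<⇒≢ i<k ∘ sym) x (lookup x k)

  prefix≥-swapRows-before : ∀ t j → j ≤ toℕ i → prefix≥ t j (swapRows x i k) ≡ prefix≥ t j x
  prefix≥-swapRows-before t j j≤i =
    trans (prefix≥-update-before t j y k (lookup x i) (≤-trans j≤i (<⇒≤ i<k)))
          (prefix≥-update-before t j x i (lookup x k) j≤i)

  prefix≥-swapRows-between : ∀ t j → toℕ i < j → j ≤ toℕ k →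
    prefix≥ t j (swapRows x i k) + 𝟙[ t ≤ lookup x i ] ≡ prefix≥ t j x + 𝟙[ t ≤ lookup x k ]
  prefix≥-swapRows-between t j i<j j≤k =
    trans (cong (_+ 𝟙[ t ≤ lookup x i ]) (prefix≥-update-before t j y k (lookup x i) j≤k))
          (prefix≥-update t j x i (lookup x k) i<j)

  prefix≥-swapRows-after : ∀ t j → toℕ k < j → prefix≥ t j (swapRows x i k) ≡ prefix≥ t j x
  prefix≥-swapRows-after t j k<j = +-cancelʳ-≡ 𝟙[ t ≤ lookup x k ] _ _ (begin
    prefix≥ t j (swapRows x i k) + 𝟙[ t ≤ lookup x k ]  ≡⟨ cong (_+_ (prefix≥ t j (swapRows x i k)) ∘ 𝟙[ t ≤_]) yₖ≡xₖ ⟨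
    prefix≥ t j (swapRows x i k) + 𝟙[ t ≤ lookup y k ]  ≡⟨ prefix≥-update t j y k (lookup x i) k<j ⟩
    prefix≥ t j y + 𝟙[ t ≤ lookup x i ]                 ≡⟨ prefix≥-update t j x i (lookup x k) (<-trans i<k k<j) ⟩
    prefix≥ t j x + 𝟙[ t ≤ lookup x k ]                 ∎)
    where open ≡-Reasoning

  swapRows-≼ : lookup x i ≤ lookup x k → x ≼ swapRows x i k
  swapRows-≼ xᵢ≤xₖ t j _ with toℕ i <? j | toℕ k <? j
  ... | _       | yes k<j = ≤-reflexive (sym (prefix≥-swapRows-after t j k<j))
  ... | no  i≮j | no  _   = ≤-reflexive (sym (prefix≥-swapRows-before t j (≮⇒≥ i≮j)))
  ... | yes i<j | no  k≮j = 𝟙-exchange-≤ (prefix≥-swapRows-between t j i<j (≮⇒≥ k≮j)) xᵢ≤xₖ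

-- Pigeonhole and greedy choice

covered⇒≤ : ∀ {n} (f : Fin n → ℕ) A L →
  (∀ c → 1 ≤ c → c ≤ L → Σ (Fin n) λ r → toℕ r < A × f r ≡ c) → L ≤ A
covered⇒≤ f A L cover = injective⇒≤ {f = row} row-injective
  where
  witness : (c : Fin L) → Σ (Fin _) λ r → toℕ r < A × f r ≡ suc (toℕ c)
  witness c = cover (suc (toℕ c)) (s≤s z≤n) (toℕ<n c)
  row : Fin L → Fin A
  row c = fromℕ< (proj₁ (proj₂ (witness c)))
  row-injective : ∀ {c c′} → row c ≡ row c′ → c ≡ c′
  row-injective {c} {c′} eq = toℕ-injective (suc-injective (begin
    suc (toℕ c)              ≡⟨ proj₂ (proj₂ (witness c)) ⟨
    f (proj₁ (witness c))    ≡⟨ cong f (toℕ-injective (trans (sym (toℕ-fromℕ< _)) (trans (cong toℕ eq) (toℕ-fromℕ< _)))) ⟩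
    f (proj₁ (witness c′))   ≡⟨ proj₂ (proj₂ (witness c′)) ⟩
    suc (toℕ c′)             ∎))
    where open ≡-Reasoning

distinct⇒≤ : ∀ {A} L (g : Fin A → ℕ) → (∀ a → 1 ≤ g a × g a ≤ L) → (∀ a b → g a ≡ g b → a ≡ b) → A ≤ L
distinct⇒≤ L g bounds distinct = injective⇒≤ {f = column} column-injective
  where
  suc-pred-g : ∀ a → suc (pred (g a)) ≡ g a
  suc-pred-g a = suc-pred (g a) {{>-nonZero (proj₁ (bounds a))}}
  column : Fin _ → Fin L
  column a = fromℕ< (subst (_≤ L) (sym (suc-pred-g a)) (proj₂ (bounds a)))
  pred-column : ∀ a → suc (toℕ (column a)) ≡ g a
  pred-column a = trans (cong suc (toℕ-fromℕ< _)) (suc-pred-g a)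
  column-injective : ∀ {a b} → column a ≡ column b → a ≡ b
  column-injective {a} {b} eq = distinct a b (trans (sym (pred-column a)) (trans (cong (suc ∘ toℕ) eq) (pred-column b)))

largestOutside : ∀ {p} {P : Pred ℕ p} → Decidable P → ℕ → ℕ
largestOutside P? zero = zero
largestOutside P? (suc l) with P? (suc l)
... | yes _ = largestOutside P? l
... | no  _ = suc l

module _ {p} {P : Pred ℕ p} (P? : Decidable P) where

  largestOutside-≤ : ∀ l → largestOutside P? l ≤ l
  largestOutside-≤ zero = z≤n
  largestOutside-≤ (suc l) with P? (suc l)
  ... | yes _ = m≤n⇒m≤1+n (largestOutside-≤ l)
  ... | no  _ = ≤-refl

  largestOutside-∉ : ∀ l → 1 ≤ largestOutside P? l → ¬ P (largestOutside P? l)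
  largestOutside-∉ (suc l) pos with P? (suc l)
  ... | yes _  = largestOutside-∉ l pos
  ... | no  ¬P = ¬P

  largestOutside-maximal : ∀ l c → 1 ≤ c → c ≤ l → ¬ P c → c ≤ largestOutside P? l
  largestOutside-maximal zero    _ (s≤s _) ()
  largestOutside-maximal (suc l) c 1≤c c≤1+l ¬Pc with P? (suc l)
  ... | no _  = c≤1+l
  ... | yes P[1+l] with m≤n⇒m<n∨m≡n c≤1+l
  ...   | inj₁ c<1+l = largestOutside-maximal l c 1≤c (≤-pred c<1+l) ¬Pc
  ...   | inj₂ refl  = ⊥-elim (¬Pc P[1+l])

maxAvail≡largestOutside : ∀ l used → maxAvail l used ≡ largestOutside (_∈? used) l
maxAvail≡largestOutside zero    used = refl
maxAvail≡largestOutside (suc l) used with suc l ∈? used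
... | yes _ = maxAvail≡largestOutside l used
... | no  _ = refl

hat1-aux-≤ : ∀ {n} used (λ' : Vec ℕ n) m → lookup (hat1-aux used λ') m ≤ lookup λ' m
hat1-aux-≤ used (l ∷ λ') Fin.zero    = subst (_≤ l) (sym (maxAvail≡largestOutside l used)) (largestOutside-≤ (_∈? used) l)
hat1-aux-≤ used (l ∷ λ') (Fin.suc m) = hat1-aux-≤ _ λ' m

hat1-aux-maximal : ∀ {n} used (λ' : Vec ℕ n) m c → 1 ≤ c → c ≤ lookup λ' m → ¬ c ∈ used →
  (∀ m′ → toℕ m′ < toℕ m → lookup (hat1-aux used λ') m′ ≢ c) → c ≤ lookup (hat1-aux used λ') m
hat1-aux-maximal used (l ∷ λ') Fin.zero    c 1≤c c≤l c∉used _ =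
  subst (c ≤_) (sym (maxAvail≡largestOutside l used)) (largestOutside-maximal (_∈? used) l c 1≤c c≤l c∉used)
hat1-aux-maximal used (l ∷ λ') (Fin.suc m) c 1≤c c≤λₘ c∉used fresh =
  hat1-aux-maximal (maxAvail l used ∷ used) λ' m c 1≤c c≤λₘ c∉used′ (λ m′ m′<m → fresh (Fin.suc m′) (s≤s m′<m))
  where
  c∉used′ : ¬ c ∈ (maxAvail l used ∷ used)
  c∉used′ (here c≡a)   = fresh Fin.zero (s≤s z≤n) (sym c≡a)
  c∉used′ (there c∈used) = c∉used c∈used

hat1-aux-∉ : ∀ {n} used (λ' : Vec ℕ n) m → 1 ≤ lookup (hat1-aux used λ') m → ¬ lookup (hat1-aux used λ') m ∈ used
hat1-aux-∉ used (l ∷ λ') Fin.zero    pos =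
  subst (λ a → ¬ a ∈ used) (sym (maxAvail≡largestOutside l used))
        (largestOutside-∉ (_∈? used) l (subst (1 ≤_) (maxAvail≡largestOutside l used) pos))
hat1-aux-∉ used (l ∷ λ') (Fin.suc m) pos = hat1-aux-∉ (maxAvail l used ∷ used) λ' m pos ∘ there

hat1-aux-fresh : ∀ {n} used (λ' : Vec ℕ n) m → 1 ≤ lookup (hat1-aux used λ') m →
  ∀ m′ → toℕ m′ < toℕ m → lookup (hat1-aux used λ') m′ ≢ lookup (hat1-aux used λ') m
hat1-aux-fresh used (l ∷ λ') (Fin.suc m) pos Fin.zero       _           eq =
  hat1-aux-∉ (maxAvail l used ∷ used) λ' m pos (here (sym eq))
hat1-aux-fresh used (l ∷ λ') (Fin.suc m) pos (Fin.suc m′) (s≤s m′<m) =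
  hat1-aux-fresh (maxAvail l used ∷ used) λ' m pos m′ m′<m

-- The maximum 1̂ and its coatoms

module Board {n} (λ' : Vec ℕ n) (partition : IsPartition λ') (row<λ : ∀ i → suc (toℕ i) ≤ lookup λ' i) where

  ℓ : Fin n → ℕ
  ℓ = lookup λ'

  top : Vec ℕ n
  top = hat1 λ'

  col : Fin n → ℕ
  col = lookup top

  Used : ℕ → ℕ → Set
  Used p c = Σ (Fin n) λ r → toℕ r < p × col r ≡ c

  used? : ∀ p c → Dec (Used p c)
  used? p c = any? (λ r → (toℕ r <? p) ×-dec (col r ≟ c))

  col≤ℓ : ∀ m → col m ≤ ℓ m
  col≤ℓ = hat1-aux-≤ [] λ'

  col-maximal : ∀ m c → 1 ≤ c → c ≤ ℓ m → ¬ Used (toℕ m) c → c ≤ col m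
  col-maximal m c 1≤c c≤ℓₘ unused =
    hat1-aux-maximal [] λ' m c 1≤c c≤ℓₘ (λ ()) (λ m′ m′<m colₘ′≡c → unused (m′ , m′<m , colₘ′≡c))

  -- hat1 falls back to column 0 only if the rows below m use all ℓ m > toℕ m columns of row m.
  col-pos : ∀ m → 1 ≤ col m
  col-pos m with 1 ≤? col m
  ... | yes pos = pos
  ... | no ¬pos = ⊥-elim (<⇒≱ (row<λ m) (covered⇒≤ col (toℕ m) (ℓ m) cover))
    where
    cover : ∀ c → 1 ≤ c → c ≤ ℓ m → Used (toℕ m) c
    cover c 1≤c c≤ℓₘ with used? (toℕ m) c
    ... | yes used = used
    ... | no  free = ⊥-elim (¬pos (≤-trans 1≤c (col-maximal m c 1≤c c≤ℓₘ free)))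

  col-fresh : ∀ m m′ → toℕ m′ < toℕ m → col m′ ≢ col m
  col-fresh m = hat1-aux-fresh [] λ' m (col-pos m)

  col-injective : ∀ a b → col a ≡ col b → a ≡ b
  col-injective a b eq with <-cmp (toℕ a) (toℕ b)
  ... | tri< a<b _ _ = ⊥-elim (col-fresh b a a<b eq)
  ... | tri≈ _ a≡b _ = toℕ-injective a≡b
  ... | tri> _ _ b<a = ⊥-elim (col-fresh a b b<a (sym eq))

  top-placement : IsPlacement λ' top
  top-placement = (λ m → col-pos m , col≤ℓ m) , col-injective

  ℓ-mono : ∀ {a b} → toℕ a ≤ toℕ b → ℓ a ≤ ℓ b
  ℓ-mono = partition _ _

  Free : Fin n → ℕ → Set
  Free i c = 1 ≤ c × c ≤ ℓ i × ¬ Used (suc (toℕ i)) c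

  -- The columns of the top rooks in rows ≤ i, together with a free column, are i + 2 distinct columns of row i.
  free⇒long : ∀ {i c} → Free i c → suc (suc (toℕ i)) ≤ ℓ i
  free⇒long {i} {c} (1≤c , c≤ℓᵢ , unused) = distinct⇒≤ (ℓ i) column bounds distinct
    where
    row : Fin (suc (toℕ i)) → Fin n
    row a = Fin.inject≤ a (toℕ<n i)
    row≤i : ∀ a → toℕ (row a) < suc (toℕ i)
    row≤i a = subst (_< suc (toℕ i)) (sym (toℕ-inject≤ a _)) (toℕ<n a)
    column : Fin (suc (suc (toℕ i))) → ℕ
    column Fin.zero    = c
    column (Fin.suc a) = col (row a)
    bounds : ∀ a → 1 ≤ column a × column a ≤ ℓ i
    bounds Fin.zero    = 1≤c , c≤ℓᵢ
    bounds (Fin.suc a) = col-pos (row a) , ≤-trans (col≤ℓ (row a)) (ℓ-mono (≤-pred (row≤i a)))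
    distinct : ∀ a b → column a ≡ column b → a ≡ b
    distinct Fin.zero    Fin.zero    _  = refl
    distinct Fin.zero    (Fin.suc b) eq = ⊥-elim (unused (row b , row≤i b , sym eq))
    distinct (Fin.suc a) Fin.zero    eq = ⊥-elim (unused (row a , row≤i a , eq))
    distinct (Fin.suc a) (Fin.suc b) eq = cong Fin.suc (inject≤-injective _ _ a b (col-injective _ _ eq))

  gjw≡0⇒ℓ≡ : ∀ {i} → gjw λ' i ≡ + 0 → ℓ i ≡ suc (toℕ i)
  gjw≡0⇒ℓ≡ {i} eq = ℤ.+-injective (ℤ.i-j≡0⇒i≡j (+ ℓ i) (+ suc (toℕ i)) eq)

  gjw≢0⇒long : ∀ {i} → gjw λ' i ≢ + 0 → suc (suc (toℕ i)) ≤ ℓ i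
  gjw≢0⇒long {i} gᵢ≢0 = ≤∧≢⇒< (row<λ i) (λ eq → gᵢ≢0 (ℤ.i≡j⇒i-j≡0 (cong +_ (sym eq))))

  free⇒gjw≢0 : ∀ {i c} → Free i c → gjw λ' i ≢ + 0
  free⇒gjw≢0 {i} free gᵢ≡0 = <-irrefl (sym (gjw≡0⇒ℓ≡ gᵢ≡0)) (free⇒long free)

  below-top-at-firstDiff : ∀ x → IsPlacement λ' x → ∀ i → AgreeBelow (toℕ i) x top → lookup x i ≢ col i →
    lookup x i < col i × ¬ Used (toℕ i) (lookup x i)
  below-top-at-firstDiff x (bounds , distinct) i agree xᵢ≢colᵢ =
    ≤∧≢⇒< (col-maximal i (lookup x i) (proj₁ (bounds i)) (proj₂ (bounds i)) unused) xᵢ≢colᵢ , unused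
    where
    unused : ¬ Used (toℕ i) (lookup x i)
    unused (r , r<i , colᵣ≡xᵢ) = <-irrefl (cong toℕ (distinct r i (trans (agree r r<i) colᵣ≡xᵢ))) r<i

  Raised : Vec ℕ n → ℕ → Set
  Raised x p = Σ (Vec ℕ n) λ x′ → IsPlacement λ' x′ × x ≼ x′ × AgreeBelow p x′ top

  raise-row : ∀ {x} → IsPlacement λ' x → ∀ r → AgreeBelow (toℕ r) x top → Raised x (suc (toℕ r))
  raise-row {x} P r agree with lookup x r ≟ col r
  ... | yes xᵣ≡colᵣ = x , P , (λ _ _ _ → ≤-refl) , AgreeBelow-suc {x = x} {top} agree xᵣ≡colᵣ
  ... | no  xᵣ≢colᵣ with below-top-at-firstDiff x P r agree xᵣ≢colᵣ | any? (λ m → lookup x m ≟ col r)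
  ...   | xᵣ<colᵣ , _ | no colᵣ-empty =
    x [ r ]≔ col r ,
    update-placement λ' x P (col-pos r) (col≤ℓ r) (λ m _ xₘ≡colᵣ → colᵣ-empty (m , xₘ≡colᵣ)) ,
    update-≼ x r (<⇒≤ xᵣ<colᵣ) ,
    AgreeBelow-suc {x = x [ r ]≔ col r} {top} (λ m m<r → trans (update-agreeBelow x r (col r) m m<r) (agree m m<r))
                   (lookup∘update r x (col r))
  ...   | xᵣ<colᵣ , _ | yes (m , xₘ≡colᵣ) =
    swapRows x r m ,
    swapRows-placement λ' x P (Fin.<⇒≢ r<m)
      (≤-trans (≤-reflexive xₘ≡colᵣ) (col≤ℓ r)) (≤-trans (proj₂ (proj₁ P r)) (ℓ-mono (<⇒≤ r<m))) ,
    swapRows-≼ x r<m (≤-trans (<⇒≤ xᵣ<colᵣ) (≤-reflexive (sym xₘ≡colᵣ))) ,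
    AgreeBelow-suc {x = swapRows x r m} {top} (λ m′ m′<r → trans (swapRows-agreeBelow x r<m m′ m′<r) (agree m′ m′<r))
                   (trans (swapRows-at-i x (Fin.<⇒≢ r<m)) xₘ≡colᵣ)
    where
    r<m : toℕ r < toℕ m
    r<m with <-cmp (toℕ r) (toℕ m)
    ... | tri< r<m _ _ = r<m
    ... | tri≈ _ r≡m _ = ⊥-elim (xᵣ≢colᵣ (subst (λ q → lookup x q ≡ col r) (sym (toℕ-injective r≡m)) xₘ≡colᵣ))
    ... | tri> _ _ m<r = ⊥-elim (col-fresh r m m<r (trans (sym (agree m m<r)) xₘ≡colᵣ))

  raise-prefix : ∀ {x p} → IsPlacement λ' x → (p<n : p < n) → AgreeBelow p x top → Raised x (suc p)
  raise-prefix {x} P p<n agree = subst (λ q → Raised x (suc q)) (toℕ-fromℕ< p<n)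
    (raise-row P (fromℕ< p<n) (subst (λ q → AgreeBelow q x top) (sym (toℕ-fromℕ< p<n)) agree))

  top-greatest-from : ∀ d p → d + p ≡ n → ∀ {x} → IsPlacement λ' x → AgreeBelow p x top → x ≼ top
  top-greatest-from zero    p refl {x} _ agree t j _ =
    ≤-reflexive (cong (prefix≥ t j) (Pointwise-≡⇒≡ (ext (λ m → agree m (toℕ<n m)))))
  top-greatest-from (suc d) p d+p≡n P agree with raise-prefix P (subst (p <_) d+p≡n (s≤s (m≤n+m p d))) agree
  ... | x′ , P′ , x≼x′ , agree′ = ≼-trans x≼x′ (top-greatest-from d (suc p) (trans (+-suc d p) d+p≡n) P′ agree′)

  top-greatest : ∀ {x} → IsPlacement λ' x → x ≼ top
  top-greatest P = top-greatest-from n 0 (+-identityʳ n) P (λ _ ())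

  free⇒below-col : ∀ {i c} → Free i c → c < col i
  free⇒below-col {i} {c} (1≤c , c≤ℓᵢ , unused) =
    ≤∧≢⇒< (col-maximal i c 1≤c c≤ℓᵢ (λ (r , r<i , colᵣ≡c) → unused (r , m<n⇒m<1+n r<i , colᵣ≡c)))
          (λ c≡colᵢ → unused (i , ≤-refl , sym c≡colᵢ))

  below-col⇒free : ∀ {i c} → 1 ≤ c → c < col i → ¬ Used (toℕ i) c → Free i c
  below-col⇒free {i} {c} 1≤c c<colᵢ unused = 1≤c , ≤-trans (<⇒≤ c<colᵢ) (col≤ℓ i) , unused′
    where
    unused′ : ¬ Used (suc (toℕ i)) c
    unused′ (r , r<1+i , colᵣ≡c) with m<1+n⇒m<n∨m≡n r<1+i
    ... | inj₁ r<i = unused (r , r<i , colᵣ≡c)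
    ... | inj₂ r≡i = <-irrefl (trans (sym colᵣ≡c) (cong col (toℕ-injective r≡i))) c<colᵢ

  partner-free : ∀ {i k} → toℕ i < toℕ k → col k < col i → Free i (col k)
  partner-free {i} {k} i<k colₖ<colᵢ = below-col⇒free (col-pos k) colₖ<colᵢ
    (λ (r , r<i , colᵣ≡colₖ) → <-irrefl (cong toℕ (col-injective r k colᵣ≡colₖ)) (<-trans r<i i<k))

  obtainable⇒free : ∀ {i x} → ObtainableOn λ' i x → Σ ℕ (Free i)
  obtainable⇒free (_ , inj₁ (k , i<k , colₖ<colᵢ , _)) = col k , partner-free i<k colₖ<colᵢ
  obtainable⇒free (_ , inj₂ (c , 1≤c , c<colᵢ , empty , _)) =
    c , below-col⇒free 1≤c c<colᵢ (λ (r , _ , colᵣ≡c) → empty r colᵣ≡c)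

  obtainable⇒lowers-row : ∀ {i x} → ObtainableOn λ' i x → AgreeBelow (toℕ i) x top × lookup x i < col i
  obtainable⇒lowers-row {i} (_ , inj₁ (k , i<k , colₖ<colᵢ , _ , refl)) =
    swapRows-agreeBelow top i<k , subst (_< col i) (sym (swapRows-at-i top (Fin.<⇒≢ i<k))) colₖ<colᵢ
  obtainable⇒lowers-row {i} (_ , inj₂ (c , _ , c<colᵢ , _ , _ , refl)) =
    update-agreeBelow top i c , subst (_< col i) (sym (lookup∘update i top c)) c<colᵢ

  module Row (i : Fin n) (long : suc (suc (toℕ i)) ≤ ℓ i) where

    target : ℕ
    target = largestOutside (used? (suc (toℕ i))) (ℓ i)

    target-maximal : ∀ {c} → Free i c → c ≤ target
    target-maximal {c} (1≤c , c≤ℓᵢ , unused) = largestOutside-maximal (used? (suc (toℕ i))) (ℓ i) c 1≤c c≤ℓᵢ unused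

    target-pos : 1 ≤ target
    target-pos with 1 ≤? target
    ... | yes pos = pos
    ... | no ¬pos = ⊥-elim (<⇒≱ long (covered⇒≤ col (suc (toℕ i)) (ℓ i) cover))
      where
      cover : ∀ c → 1 ≤ c → c ≤ ℓ i → Used (suc (toℕ i)) c
      cover c 1≤c c≤ℓᵢ with used? (suc (toℕ i)) c
      ... | yes used = used
      ... | no  free = ⊥-elim (¬pos (≤-trans 1≤c (target-maximal (1≤c , c≤ℓᵢ , free))))

    target-unused : ¬ Used (suc (toℕ i)) target
    target-unused = largestOutside-∉ (used? (suc (toℕ i))) (ℓ i) target-pos

    target-free : Free i target
    target-free = target-pos , largestOutside-≤ (used? (suc (toℕ i))) (ℓ i) , target-unused

    target<col : target < col i
    target<col = free⇒below-col target-free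

    target≤ℓ : ∀ {m} → toℕ i ≤ toℕ m → target ≤ ℓ m
    target≤ℓ i≤m = ≤-trans (proj₁ (proj₂ target-free)) (ℓ-mono i≤m)

    between-used : ∀ c → target < c → c < col i → Used (toℕ i) c
    between-used c target<c c<colᵢ with used? (toℕ i) c
    ... | yes used = used
    ... | no  free = ⊥-elim (<⇒≱ target<c (target-maximal (below-col⇒free (<-≤-trans z<s target<c) c<colᵢ free)))

    col-above : ∀ m → toℕ i < toℕ m → ¬ Used (suc (toℕ m)) target → col i < col m
    col-above m i<m unheld with col m ≤? col i
    ... | no  colₘ≰colᵢ = ≰⇒> colₘ≰colᵢ
    ... | yes colₘ≤colᵢ with between-used (col m) target<colₘ colₘ<colᵢ
      where
      target<colₘ : target < col m
      target<colₘ = ≤∧≢⇒<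
        (col-maximal m target target-pos (target≤ℓ (<⇒≤ i<m)) (λ (r , r<m , colᵣ≡t) → unheld (r , m<n⇒m<1+n r<m , colᵣ≡t)))
        (λ target≡colₘ → unheld (m , ≤-refl , sym target≡colₘ))
      colₘ<colᵢ : col m < col i
      colₘ<colᵢ = ≤∧≢⇒< colₘ≤colᵢ (λ colₘ≡colᵢ → Fin.<⇒≢ i<m (col-injective i m (sym colₘ≡colᵢ)))
    ...   | r , r<i , colᵣ≡colₘ = ⊥-elim (Fin.<⇒≢ (<-trans r<i i<m) (col-injective r m colᵣ≡colₘ))

    -- counts: each prefix of y has the entries of that of top, possibly with col i replaced by target.
    record Lowered (y : Vec ℕ n) : Set where
      field
        placement : IsPlacement λ' y
        agree     : AgreeBelow (toℕ i) y top
        at-row    : lookup y i ≡ target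
        counts    : ∀ t j → prefix≥ t j y ≡ prefix≥ t j top ⊎
                      (toℕ i < j × (∀ m → toℕ i < toℕ m → toℕ m < j → col i < col m) ×
                       prefix≥ t j y + 𝟙[ t ≤ col i ] ≡ prefix≥ t j top + 𝟙[ t ≤ target ])

    switch-lowered : ∀ k → col k ≡ target → Σ (Vec ℕ n) λ y → Lowered y × ObtainableOn λ' i y
    switch-lowered k colₖ≡target =
      swapRows top i k , lowered , placement lowered , inj₁ (k , i<k , colₖ<colᵢ , empty , refl)
      where
      open Lowered
      colₖ<colᵢ : col k < col i
      colₖ<colᵢ = subst (_< col i) (sym colₖ≡target) target<col
      i<k : toℕ i < toℕ k
      i<k with toℕ k ≤? toℕ i
      ... | yes k≤i = ⊥-elim (target-unused (k , s≤s k≤i , colₖ≡target))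
      ... | no  k≰i = ≰⇒> k≰i
      between : ∀ m → toℕ i < toℕ m → toℕ m < toℕ k → col i < col m
      between m i<m m<k = col-above m i<m (λ (r , r≤m , colᵣ≡t) →
        <⇒≱ m<k (subst (λ q → toℕ q ≤ toℕ m) (col-injective r k (trans colᵣ≡t (sym colₖ≡target))) (≤-pred r≤m)))
      empty : ∀ m → m ≢ i → m ≢ k → ¬ (i Fin.≤ m × m Fin.≤ k × col k ≤ col m × col m ≤ col i)
      empty m m≢i m≢k (i≤m , m≤k , _ , colₘ≤colᵢ) =
        <⇒≱ (between m (≤∧≢⇒< i≤m (m≢i ∘ toℕ-injective ∘ sym)) (≤∧≢⇒< m≤k (m≢k ∘ toℕ-injective)))
            colₘ≤colᵢ
      lowered : Lowered (swapRows top i k)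
      lowered .placement = swapRows-placement λ' top top-placement (Fin.<⇒≢ i<k)
        (subst (_≤ ℓ i) (sym colₖ≡target) (target≤ℓ ≤-refl)) (≤-trans (col≤ℓ i) (ℓ-mono (<⇒≤ i<k)))
      lowered .agree = swapRows-agreeBelow top i<k
      lowered .at-row = trans (swapRows-at-i top (Fin.<⇒≢ i<k)) colₖ≡target
      lowered .counts t j with toℕ i <? j | toℕ k <? j
      ... | _       | yes k<j = inj₁ (prefix≥-swapRows-after top i<k t j k<j)
      ... | no  i≮j | no  _   = inj₁ (prefix≥-swapRows-before top i<k t j (≮⇒≥ i≮j))
      ... | yes i<j | no  k≮j = inj₂ (i<j , (λ m i<m m<j → between m i<m (<-≤-trans m<j (≮⇒≥ k≮j))) ,
        trans (prefix≥-swapRows-between top i<k t j i<j (≮⇒≥ k≮j)) (cong (λ c → _ + 𝟙[ t ≤ c ]) colₖ≡target))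

    push-lowered : (∀ m → col m ≢ target) → Σ (Vec ℕ n) λ y → Lowered y × ObtainableOn λ' i y
    push-lowered unheld =
      top [ i ]≔ target , lowered , placement lowered , inj₂ (target , target-pos , target<col , unheld , between-used , refl)
      where
      open Lowered
      above : ∀ m → toℕ i < toℕ m → col i < col m
      above m i<m = col-above m i<m (λ (r , _ , colᵣ≡t) → unheld r colᵣ≡t)
      lowered : Lowered (top [ i ]≔ target)
      lowered .placement = update-placement λ' top top-placement target-pos (target≤ℓ ≤-refl) (λ m _ → unheld m)
      lowered .agree = update-agreeBelow top i target
      lowered .at-row = lookup∘update i top target
      lowered .counts t j with toℕ i <? j
      ... | no  i≮j = inj₁ (prefix≥-update-before t j top i target (≮⇒≥ i≮j))
      ... | yes i<j = inj₂ (i<j , (λ m i<m _ → above m i<m) , prefix≥-update t j top i target i<j)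

    lowered : Σ (Vec ℕ n) λ y → Lowered y × ObtainableOn λ' i y
    lowered with any? (λ k → col k ≟ target)
    ... | yes (k , colₖ≡target) = switch-lowered k colₖ≡target
    ... | no  unheld            = push-lowered (λ m colₘ≡target → unheld (m , colₘ≡target))

    partner-holds-target : ∀ {k} → toℕ i < toℕ k → col k < col i →
      (∀ m → m ≢ i → m ≢ k → ¬ (i Fin.≤ m × m Fin.≤ k × col k ≤ col m × col m ≤ col i)) → col k ≡ target
    partner-holds-target {k} i<k colₖ<colᵢ empty =
      ≤-antisym colₖ≤target (col-maximal k target target-pos (target≤ℓ (<⇒≤ i<k)) unheld)
      where
      colₖ≤target : col k ≤ target
      colₖ≤target = target-maximal (partner-free i<k colₖ<colᵢ)
      unheld : ¬ Used (toℕ k) target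
      unheld (r , r<k , colᵣ≡t) with toℕ r ≤? toℕ i
      ... | yes r≤i = target-unused (r , s≤s r≤i , colᵣ≡t)
      ... | no  r≰i = empty r (Fin.<⇒≢ i<r ∘ sym) (Fin.<⇒≢ r<k)
        (<⇒≤ i<r , <⇒≤ r<k , subst (col k ≤_) (sym colᵣ≡t) colₖ≤target ,
         subst (_≤ col i) (sym colᵣ≡t) (<⇒≤ target<col))
        where
        i<r : toℕ i < toℕ r
        i<r = ≰⇒> r≰i

    push-column≡target : ∀ {c} → 1 ≤ c → c < col i → (∀ m → col m ≢ c) →
      (∀ r → c < r → r < col i → Σ (Fin n) λ m → m Fin.< i × col m ≡ r) → c ≡ target
    push-column≡target {c} 1≤c c<colᵢ empty filled with m≤n⇒m<n∨m≡n c≤target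
      where
      c≤target : c ≤ target
      c≤target = target-maximal (below-col⇒free 1≤c c<colᵢ (λ (r , _ , colᵣ≡c) → empty r colᵣ≡c))
    ... | inj₂ c≡target = c≡target
    ... | inj₁ c<target with filled target c<target target<col
    ...   | m , m<i , colₘ≡target = ⊥-elim (target-unused (m , m<n⇒m<1+n m<i , colₘ≡target))

    switch-push-exclusive : ∀ {x x′} → SwitchMove i top x → ¬ PushMove i top x′
    switch-push-exclusive (k , i<k , colₖ<colᵢ , empty , _) (c , 1≤c , c<colᵢ , unheld , filled , _) =
      unheld k (trans (partner-holds-target i<k colₖ<colᵢ empty) (sym (push-column≡target 1≤c c<colᵢ unheld filled)))

    obtainable-unique : ∀ {x x′} → ObtainableOn λ' i x → ObtainableOn λ' i x′ → x ≡ x′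
    obtainable-unique (_ , inj₁ (k , i<k , colₖ<colᵢ , empty , refl))
                      (_ , inj₁ (k′ , i<k′ , colₖ′<colᵢ , empty′ , refl)) =
      cong (swapRows top i) (col-injective k k′
        (trans (partner-holds-target i<k colₖ<colᵢ empty) (sym (partner-holds-target i<k′ colₖ′<colᵢ empty′))))
    obtainable-unique (_ , inj₂ (c , 1≤c , c<colᵢ , unheld , filled , refl))
                      (_ , inj₂ (c′ , 1≤c′ , c′<colᵢ , unheld′ , filled′ , refl)) =
      cong (top [ i ]≔_)
        (trans (push-column≡target 1≤c c<colᵢ unheld filled) (sym (push-column≡target 1≤c′ c′<colᵢ unheld′ filled′)))
    obtainable-unique (_ , inj₁ switch) (_ , inj₂ push) = ⊥-elim (switch-push-exclusive switch push)
    obtainable-unique (_ , inj₂ push) (_ , inj₁ switch) = ⊥-elim (switch-push-exclusive switch push)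

    move : Vec ℕ n
    move = proj₁ lowered

    move-lowered : Lowered move
    move-lowered = proj₁ (proj₂ lowered)

    move-obtainable : ObtainableOn λ' i move
    move-obtainable = proj₂ (proj₂ lowered)

    open Lowered move-lowered

    Dropped : ℕ → ℕ → Set
    Dropped t j = target < t × t ≤ col i × toℕ i < j × (∀ m → toℕ i < toℕ m → toℕ m < j → col i < col m)

    move-counts : ∀ t j →
      prefix≥ t j move ≡ prefix≥ t j top ⊎ (Dropped t j × suc (prefix≥ t j move) ≡ prefix≥ t j top)
    move-counts t j with counts t j
    ... | inj₁ same = inj₁ same
    ... | inj₂ (i<j , above , eq) with 𝟙-exchange eq (<⇒≤ target<col)
    ...   | inj₁ same = inj₁ same
    ...   | inj₂ (target<t , t≤colᵢ , drop) = inj₂ ((target<t , t≤colᵢ , i<j , above) , drop)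

    move≼top : move ≼ top
    move≼top t j _ with move-counts t j
    ... | inj₁ same       = ≤-reflexive same
    ... | inj₂ (_ , drop) = ≤-trans (n≤1+n _) (≤-reflexive drop)

    move≢top : move ≢ top
    move≢top move≡top = <-irrefl (trans (sym at-row) (cong (λ v → lookup v i) move≡top)) target<col

    ≼move : ∀ x → IsPlacement λ' x → AgreeBelow (toℕ i) x top → lookup x i ≢ col i → x ≼ move
    ≼move x P agreeₓ xᵢ≢colᵢ t j j≤n with move-counts t j
    ... | inj₁ same = subst (prefix≥ t j x ≤_) (sym same) (top-greatest P t j j≤n)
    ... | inj₂ ((target<t , t≤colᵢ , i<j , above) , drop) =
      ≤-pred (subst (prefix≥ t j x <_) (sym drop) (prefix≥-gap t x top i agreeₓ xᵢ<t t≤colᵢ j i<j j≤n t≤topₘ))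
      where
      t≤topₘ : ∀ m → toℕ i < toℕ m → toℕ m < j → t ≤ col m
      t≤topₘ m i<m m<j = ≤-trans t≤colᵢ (<⇒≤ (above m i<m m<j))
      xᵢ<t : lookup x i < t
      xᵢ<t with below-top-at-firstDiff x P i agreeₓ xᵢ≢colᵢ
      ... | xᵢ<colᵢ , unused = ≤-<-trans (target-maximal (below-col⇒free (proj₁ (proj₁ P i)) xᵢ<colᵢ unused)) target<t

    counts-off-row : ∀ m → m ≢ i → prefix≥ (col m) (suc (toℕ m)) move ≡ prefix≥ (col m) (suc (toℕ m)) top
    counts-off-row m m≢i with move-counts (col m) (suc (toℕ m))
    ... | inj₁ same = same
    ... | inj₂ ((_ , colₘ≤colᵢ , i<1+m , above) , _) =
      ⊥-elim (<⇒≱ (above m (≤∧≢⇒< (≤-pred i<1+m) (m≢i ∘ toℕ-injective ∘ sym)) ≤-refl) colₘ≤colᵢ)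

    firstDiff-above-move : ∀ z → IsPlacement λ' z → move ≼ z →
      ∀ r → AgreeBelow (toℕ r) z top → lookup z r ≢ col r → r ≡ i
    firstDiff-above-move z P move≼z r agreeᵣ differᵣ with r Fin.≟ i
    ... | yes r≡i = r≡i
    ... | no  r≢i = ⊥-elim (<⇒≱ zᵣ-drop (begin
      prefix≥ (col r) (suc (toℕ r)) top   ≡⟨ counts-off-row r r≢i ⟨
      prefix≥ (col r) (suc (toℕ r)) move  ≤⟨ move≼z (col r) (suc (toℕ r)) (toℕ<n r) ⟩
      prefix≥ (col r) (suc (toℕ r)) z     ∎))
      where
      open ≤-Reasoning
      zᵣ-drop : prefix≥ (col r) (suc (toℕ r)) z < prefix≥ (col r) (suc (toℕ r)) top
      zᵣ-drop = prefix≥-gap (col r) z top r agreeᵣ (proj₁ (below-top-at-firstDiff z P r agreeᵣ differᵣ)) ≤-refl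
                  (suc (toℕ r)) ≤-refl (toℕ<n r) (λ m r<m m<1+r → ⊥-elim (<⇒≱ r<m (≤-pred m<1+r)))

    above-move : ∀ z → IsPlacement λ' z → move ≼ z → z ≡ move ⊎ z ≡ top
    above-move z P move≼z with ≡-dec _≟_ z top
    ... | yes z≡top = inj₂ z≡top
    ... | no  z≢top with firstDiff z top z≢top
    ...   | r , agreeᵣ , differᵣ with firstDiff-above-move z P move≼z r agreeᵣ differᵣ
    ...     | refl =
      inj₁ (prefix≥-injective (λ t j j≤n → ≤-antisym (≼move z P agreeᵣ differᵣ t j j≤n) (move≼z t j j≤n)))

    move-coatom : IsCoatom λ' move
    move-coatom = placement , ≼⇒≤P move≼top , move≢top , λ z P move≤z _ → above-move z P (≤P⇒≼ move≤z)

  coatom⇒obtainable : ∀ x → IsCoatom λ' x → Σ (Fin n) λ i → gjw λ' i ≢ + 0 × ObtainableOn λ' i x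
  coatom⇒obtainable x (P , _ , x≢top , nothing-between) with firstDiff x top x≢top
  ... | i , agree , differ with below-top-at-firstDiff x P i agree differ
  ...   | xᵢ<colᵢ , unused = i , free⇒gjw≢0 free , subst (ObtainableOn λ' i) move≡x move-obtainable
    where
    free : Free i (lookup x i)
    free = below-col⇒free (proj₁ (proj₁ P i)) xᵢ<colᵢ unused
    open Row i (free⇒long free)
    move≡x : move ≡ x
    move≡x with nothing-between move (proj₁ move-obtainable) (≼⇒≤P (≼move x P agree differ)) (≼⇒≤P move≼top)
    ... | inj₁ move≡x   = move≡x
    ... | inj₂ move≡top = ⊥-elim (move≢top move≡top)

  unique-move : ∀ i → gjw λ' i ≢ + 0 →
    Σ (Vec ℕ n) λ x → ObtainableOn λ' i x × (∀ x′ → ObtainableOn λ' i x′ → x′ ≡ x)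
  unique-move i gᵢ≢0 = move , move-obtainable , λ _ obtainable → obtainable-unique obtainable move-obtainable
    where open Row i (gjw≢0⇒long gᵢ≢0)

  no-move : ∀ i → gjw λ' i ≡ + 0 → ∀ x → ¬ ObtainableOn λ' i x
  no-move i gᵢ≡0 x obtainable = free⇒gjw≢0 (proj₂ (obtainable⇒free obtainable)) gᵢ≡0

  obtainable⇒coatom : ∀ i x → gjw λ' i ≢ + 0 → ObtainableOn λ' i x → IsCoatom λ' x
  obtainable⇒coatom i x gᵢ≢0 obtainable =
    subst (IsCoatom λ') (obtainable-unique move-obtainable obtainable) move-coatom
    where open Row i (gjw≢0⇒long gᵢ≢0)

  obtainable-row-unique : ∀ {i j x} → ObtainableOn λ' i x → ObtainableOn λ' j x → i ≡ j
  obtainable-row-unique {x = x} obtainableᵢ obtainableⱼ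
    with obtainable⇒lowers-row obtainableᵢ | obtainable⇒lowers-row obtainableⱼ
  ... | agreeᵢ , xᵢ<colᵢ | agreeⱼ , xⱼ<colⱼ =
    firstDiff-unique x top agreeᵢ (<⇒≢ xᵢ<colᵢ) agreeⱼ (<⇒≢ xⱼ<colⱼ)

mainTheorem6 : (n : ℕ) (λ' : Vec ℕ n) → IsPartition λ' →
    (∀ (i : Fin n) → suc (toℕ i) ≤ lookup λ' i) →
    ((∀ (i : Fin n) → gjw λ' i ≢ + 0 →
        Σ (Vec ℕ n) λ x → ObtainableOn λ' i x ×
          (∀ (x' : Vec ℕ n) → ObtainableOn λ' i x' → x' ≡ x)) ×
     (∀ (i : Fin n) → gjw λ' i ≡ + 0 → ∀ (x : Vec ℕ n) → ¬ ObtainableOn λ' i x)) ×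
    ((∀ (i : Fin n) (x : Vec ℕ n) → gjw λ' i ≢ + 0 → ObtainableOn λ' i x → IsCoatom λ' x) ×
     (∀ (x : Vec ℕ n) → IsCoatom λ' x →
        Σ (Fin n) λ i → gjw λ' i ≢ + 0 × ObtainableOn λ' i x) ×
     (∀ (i j : Fin n) (x : Vec ℕ n) → gjw λ' i ≢ + 0 → gjw λ' j ≢ + 0 →
        ObtainableOn λ' i x → ObtainableOn λ' j x → i ≡ j))
mainTheorem6 n λ' partition row<λ =
  (unique-move , no-move) , (obtainable⇒coatom , coatom⇒obtainable , λ _ _ _ _ _ → obtainable-row-unique)
  where open Board λ' partition row<λ
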